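{- For all $\nu,\tau,\eta\in(0,1)$ there exists $d_0>0$ such that for all $0<d\le d_0$ there exists $\varepsilon_0>0$ such that for all $0<\varepsilon\le\varepsilon_0$ and every positive integer $M'$ there exists $n_0$ such that the following holds. Let $G$ be a digraph on $n\ge n_0$ vertices with $\delta^0(G)\ge\eta n$ which is a robust $(\nu,\tau)$-outexpander. Suppose $V_0,V_1,\dots,V_k$ is a partition of $V(G)$ and $G'$ a spanning subdigraph of $G$ such that: $k\ge M'$; $|V_0|\le\varepsilon n$; $|V_1|=\dots=|V_k|=:m$; $d^+_{G'}(x)>d^+_G(x)-(d+\varepsilon)n$ and $d^-_{G'}(x)>d^-_G(x)-(d+\varepsilon)n$ for all $x\in V(G)$; $G'[V_i]$ has no edges for $i=1,\dots,k$; and for all $1\le i\ne j\le k$ the pair $(V_i,V_j)_{G'}$ is $\varepsilon$-regular with density either $0$ or at least $d$. Let $R$ be the digraph with vertex set $\{V_1,\dots,V_k\}$ in which $V_iV_j$ is an edge precisely when $(V_i,V_j)_{G'}$ is $\varepsilon$-regular and has density at least $d$. Then $\delta^0(R)\ge \eta|R|/2$ and $R$ is a robust $(\nu/2,2\tau)$-outexpander.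
   Context: Digraphs have no loops and at most one edge in each direction between any pair of vertices. $\delta^0(G)$ is the minimum of the minimum out- and indegree. For an undirected bipartite graph with classes $A,B$, the density is $d(A,B)=e(A,B)/(|A||B|)$, and the graph is $\varepsilon$-regular if $|d(X,Y)-d(A,B)|<\varepsilon$ for all $X\subseteq A$, $Y\subseteq B$ with $|X|>\varepsilon|A|$, $|Y|>\varepsilon|B|$. For disjoint vertex sets $A,B$ of a digraph $G'$, $(A,B)_{G'}$ is the bipartite graph with classes $A,B$ whose edges are the edges of $G'$ directed from $A$ to $B$; it is $\varepsilon$-regular with density $d$ if its underlying bipartite graph is. For $S\subseteq V(G)$, $RN^+_{\nu,G}(S)$ is the set of vertices with at least $\nu|G|$ inneighbours in $S$; $G$ is a robust $(\nu,\tau)$-outexpander if $|RN^+_{\nu,G}(S)|\ge|S|+\nu|G|$ whenever $\tau|G|<|S|<(1-\tau)|G|$.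
   Formalization: The parameters ν, τ, η, d and ε range over the rationals in place of arbitrary numbers, so robust outexpansion and the minimum semidegree bound are taken with rational parameters. -}

module Defs where

open import Data.Bool using (Bool; true; false; _∧_; not; if_then_else_)
open import Data.Nat as ℕ using (ℕ; zero; suc)
open import Data.Integer using (+_)
open import Data.Rational using (ℚ; _/_; _+_; _-_; _*_; _≤_; _<_; 0ℚ) renaming (∣_∣ to absℚ)
open import Data.Rational.Properties using (_≤?_; _<?_)
open import Data.Fin using (Fin; _≟_)
open import Data.Fin.Subset using (Subset; _∈_; _⊆_; _∩_; ∣_∣)
open import Data.Fin.Subset.Properties using (_⊆?_; anySubset?)
open import Data.Vec using (tabulate; lookup)
open import Data.Vec.Functional using ()
open import Data.Product using (Σ; ∃; ∃-syntax; _×_; _,_)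
open import Data.Sum using (_⊎_)
open import Relation.Nullary using (Dec; yes; no; ¬_; does)
open import Relation.Nullary.Decidable using (_→-dec_; ¬?; decidable-stable)
open import Relation.Binary.PropositionalEquality using (_≡_; refl; _≢_)

⟦_⟧ : ℕ → ℚ
⟦ n ⟧ = (+ n) / 1

-- A digraph on vertex set Fin n: adjacency x→y as a Bool, no loops.
-- (A relation automatically gives at most one edge in each direction.)
record Digraph (n : ℕ) : Set where
  field
    adj      : Fin n → Fin n → Bool
    loopless : ∀ x → adj x x ≡ false
open Digraph public

N⁺ : ∀ {n} → Digraph n → Fin n → Subset n
N⁺ G x = tabulate (λ y → adj G x y)

N⁻ : ∀ {n} → Digraph n → Fin n → Subset n
N⁻ G y = tabulate (λ x → adj G x y)

outdeg indeg : ∀ {n} → Digraph n → Fin n → ℕ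
outdeg G x = ∣ N⁺ G x ∣
indeg  G x = ∣ N⁻ G x ∣

MinSemiDegAtLeast : ∀ {n} → Digraph n → ℚ → Set
MinSemiDegAtLeast G r = ∀ x → (r ≤ ⟦ outdeg G x ⟧) × (r ≤ ⟦ indeg G x ⟧)

RN⁺ : ∀ {n} → ℚ → Digraph n → Subset n → Subset n
RN⁺ {n} ν G S = tabulate (λ y → does (ν * ⟦ n ⟧ ≤? ⟦ ∣ S ∩ N⁻ G y ∣ ⟧))

RobustOutexpander : ∀ {n} → ℚ → ℚ → Digraph n → Set
RobustOutexpander {n} ν τ G =
  ∀ (S : Subset n) → τ * ⟦ n ⟧ < ⟦ ∣ S ∣ ⟧ → ⟦ ∣ S ∣ ⟧ < (⟦ 1 ⟧ - τ) * ⟦ n ⟧ →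
    ⟦ ∣ S ∣ ⟧ + ν * ⟦ n ⟧ ≤ ⟦ ∣ RN⁺ ν G S ∣ ⟧

sumFin : ∀ {n} → (Fin n → ℕ) → ℕ
sumFin {zero}  f = 0
sumFin {suc n} f = f Fin.zero ℕ.+ sumFin (λ i → f (Fin.suc i))

edges : ∀ {n} → Digraph n → Subset n → Subset n → ℕ
edges G X Y = sumFin (λ x → if lookup X x then ∣ Y ∩ N⁺ G x ∣ else 0)

-- e / (a*b), taken to be 0 when a*b = 0 (never used in that case below
-- except for empty classes)
ratio : ℕ → ℕ → ℚ
ratio e zero    = 0ℚ
ratio e (suc p) = (+ e) / suc p

density : ∀ {n} → Digraph n → Subset n → Subset n → ℚ
density G X Y = ratio (edges G X Y) (∣ X ∣ ℕ.* ∣ Y ∣)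

RegCond : ∀ {n} → ℚ → Digraph n → Subset n → Subset n → Subset n → Subset n → Set
RegCond ε G A B X Y =
  X ⊆ A → Y ⊆ B → ε * ⟦ ∣ A ∣ ⟧ < ⟦ ∣ X ∣ ⟧ → ε * ⟦ ∣ B ∣ ⟧ < ⟦ ∣ Y ∣ ⟧ →
    absℚ (density G X Y - density G A B) < ε

Regular : ∀ {n} → ℚ → Digraph n → Subset n → Subset n → Set
Regular {n} ε G A B = ∀ (X Y : Subset n) → RegCond ε G A B X Y

private
  allSubset? : ∀ {n} {P : Subset n → Set} → (∀ X → Dec (P X)) → Dec (∀ X → P X)
  allSubset? {P = P} P? with anySubset? (λ X → ¬? (P? X))
  ... | yes (X , ¬p) = no (λ f → ¬p (f X))
  ... | no h = yes (λ X → decidable-stable (P? X) (λ ¬p → h (X , ¬p)))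

  regCond? : ∀ {n} ε (G : Digraph n) A B X Y → Dec (RegCond ε G A B X Y)
  regCond? ε G A B X Y =
    (X ⊆? A) →-dec ((Y ⊆? B) →-dec ((ε * ⟦ ∣ A ∣ ⟧ <? ⟦ ∣ X ∣ ⟧) →-dec
      ((ε * ⟦ ∣ B ∣ ⟧ <? ⟦ ∣ Y ∣ ⟧) →-dec (absℚ (density G X Y - density G A B) <? ε))))

regular? : ∀ {n} ε (G : Digraph n) A B → Dec (Regular ε G A B)
regular? ε G A B = allSubset? (λ X → allSubset? (λ Y → regCond? ε G A B X Y))

-- the partition V₀,V₁,…,V_k given by a labelling part : V(G) → {0,…,k}
class : ∀ {n k} → (Fin n → Fin (suc k)) → Fin (suc k) → Subset n
class part i = tabulate (λ x → does (part x ≟ i))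

-- V_i for i = 1,…,k (indexed by Fin k)
cluster : ∀ {n k} → (Fin n → Fin (suc k)) → Fin k → Subset n
cluster part i = class part (Fin.suc i)

SubDigraph : ∀ {n} → Digraph n → Digraph n → Set
SubDigraph G' G = ∀ x y → adj G' x y ≡ true → adj G x y ≡ true

private
  notSelf : ∀ {k} (i : Fin k) → not (does (i ≟ i)) ≡ false
  notSelf i with i ≟ i
  ... | yes _ = refl
  ... | no ¬p with () ← ¬p refl

reduced : ∀ {n k} → ℚ → ℚ → Digraph n → (Fin n → Fin (suc k)) → Digraph k
reduced ε d G' part = record
  { adj = λ i j → not (does (i ≟ j))
                  ∧ (does (regular? ε G' (cluster part i) (cluster part j))
                  ∧ does (d ≤? density G' (cluster part i) (cluster part j)))
  ; loopless = λ i → helper i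
  }
  where
  helper : ∀ i → (not (does (i ≟ i)) ∧ _) ≡ false
  helper i rewrite notSelf i = refl

module Submission where

-- Every edge of G' from a cluster V_i to a cluster V_j forces the edge ij of
-- R: i ≠ j since clusters span no edges, and the pair (V_i,V_j)_{G'} has
-- positive density, hence density at least d.  Consequently the neighbours
-- in G' of a vertex of V_i lie in V₀ together with m·d_R(i) vertices of
-- clusters.  As G' keeps all but (d+ε)n of each degree and |V₀| ≤ εn, the
-- degrees of G, divided by m ≤ n/k, give δ⁰(R) ≥ ηk/2.  For expansion, a set
-- S of clusters blows up to a vertex set S' of size about |S|m, so S' lies in
-- the range where G expands; every vertex of RN⁺_ν(S') in a cluster V_j puts
-- j into RN⁺_{ν/2}(S), and counting clusters again yields the expansion of R.
--
-- The constants are d₀ = min(η,ν)/8, ε₀ = d and n₀ = 1; then d + 2ε is at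
-- most min(η,ν)/2, which absorbs all the error terms.

open import Defs
open import Data.Bool using (Bool; true; false; _∧_; not; if_then_else_)
open import Data.Nat as ℕ using (ℕ; zero; suc)
import Data.Nat.Properties as ℕP
open import Data.Integer as ℤ using (+_)
import Data.Integer.Properties as ℤP
open import Data.Rational
  using (ℚ; _/_; _+_; _-_; _*_; _≤_; _<_; -_; 0ℚ; 1ℚ; ½; _⊓_; toℚᵘ; positive; nonNegative)
open import Data.Rational.Properties
  using (_≤?_; ≤-trans; <⇒≤; ≤-<-trans; <-≤-trans; <-irrefl; ≤ᵇ⇒≤; positive⁻¹; normalize-pos;
         toℚᵘ-injective; toℚᵘ-fromℚᵘ; toℚᵘ-homo-+; toℚᵘ-homo-*; nonNegative⁻¹; normalize-nonNeg;
         +-comm; +-identityˡ; +-identityʳ; *-identityˡ; ⊓-sel; p⊓q≤p; p⊓q≤q;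
         +-mono-≤; +-monoˡ-≤; +-monoʳ-≤; +-monoˡ-<; +-monoʳ-<; *-zeroˡ; *-distribʳ-+;
         *-monoʳ-≤-nonNeg; *-monoˡ-≤-nonNeg; *-monoˡ-<-pos; *-cancelʳ-<-nonNeg; *-cancelʳ-≤-pos; module ≤-Reasoning)
open import Data.Rational.Solver using (module +-*-Solver)
open +-*-Solver using (solve; _:+_; _:-_; _:*_; _:=_; con)
open import Data.Unit using (tt)
import Data.Rational.Unnormalised as ℚᵘ
import Data.Rational.Unnormalised.Properties as ℚᵘP
open import Data.Fin using (Fin; _≟_)
open import Data.Fin.Subset using (Subset; _∩_; ∣_∣)
open import Data.Vec using ([]; _∷_; tabulate; lookup)
open import Data.Vec.Properties using (lookup∘tabulate; lookup-zipWith)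
import Data.Vec.Functional as Vector
open import Data.Product using (∃; ∃-syntax; _×_; _,_; proj₁; proj₂)
open import Data.Sum using (_⊎_; inj₁; inj₂)
open import Relation.Nullary using (Dec; yes; no; does; contradiction)
open import Relation.Nullary.Decidable using (dec-true; dec-false)
open import Relation.Binary.PropositionalEquality
open import Algebra.Properties.Semiring.Sum ℕP.+-*-semiring
  using (sum; sum-cong-≗; sum-remove; sum-replicate-zero; ∑-comm; ∑-distrib-+; *-distribʳ-sum)

⟦_⟧ᵘ : ℕ → ℚᵘ.ℚᵘ
⟦ n ⟧ᵘ = ℚᵘ.mkℚᵘ (+ n) 0

toℚᵘ-⟦⟧ : ∀ n → toℚᵘ ⟦ n ⟧ ℚᵘ.≃ ⟦ n ⟧ᵘ
toℚᵘ-⟦⟧ n = toℚᵘ-fromℚᵘ ⟦ n ⟧ᵘ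

⟦+⟧ : ∀ a b → ⟦ a ℕ.+ b ⟧ ≡ ⟦ a ⟧ + ⟦ b ⟧
⟦+⟧ a b = toℚᵘ-injective (begin
    toℚᵘ ⟦ a ℕ.+ b ⟧                  ≈⟨ toℚᵘ-⟦⟧ (a ℕ.+ b) ⟩
    ⟦ a ℕ.+ b ⟧ᵘ                      ≈⟨ ℚᵘ.*≡* (cong (ℤ._* + 1)
                                           (cong₂ ℤ._+_ (sym (ℤP.*-identityʳ (+ a))) (sym (ℤP.*-identityʳ (+ b))))) ⟩
    ⟦ a ⟧ᵘ ℚᵘ.+ ⟦ b ⟧ᵘ                ≈⟨ ℚᵘP.+-cong (toℚᵘ-⟦⟧ a) (toℚᵘ-⟦⟧ b) ⟨
    toℚᵘ ⟦ a ⟧ ℚᵘ.+ toℚᵘ ⟦ b ⟧        ≈⟨ toℚᵘ-homo-+ ⟦ a ⟧ ⟦ b ⟧ ⟨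
    toℚᵘ (⟦ a ⟧ + ⟦ b ⟧)              ∎)
  where open ℚᵘP.≃-Reasoning

⟦*⟧ : ∀ a b → ⟦ a ℕ.* b ⟧ ≡ ⟦ a ⟧ * ⟦ b ⟧
⟦*⟧ a b = toℚᵘ-injective (begin
    toℚᵘ ⟦ a ℕ.* b ⟧                  ≈⟨ toℚᵘ-⟦⟧ (a ℕ.* b) ⟩
    ⟦ a ℕ.* b ⟧ᵘ                      ≈⟨ ℚᵘ.*≡* (cong (ℤ._* + 1) (ℤP.pos-* a b)) ⟩
    ⟦ a ⟧ᵘ ℚᵘ.* ⟦ b ⟧ᵘ                ≈⟨ ℚᵘP.*-cong (toℚᵘ-⟦⟧ a) (toℚᵘ-⟦⟧ b) ⟨
    toℚᵘ ⟦ a ⟧ ℚᵘ.* toℚᵘ ⟦ b ⟧        ≈⟨ toℚᵘ-homo-* ⟦ a ⟧ ⟦ b ⟧ ⟨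
    toℚᵘ (⟦ a ⟧ * ⟦ b ⟧)              ∎)
  where open ℚᵘP.≃-Reasoning

⟦⟧-nonNeg : ∀ n → 0ℚ ≤ ⟦ n ⟧
⟦⟧-nonNeg n = nonNegative⁻¹ ⟦ n ⟧ {{normalize-nonNeg n 1}}

⟦⟧-mono-≤ : ∀ {a b} → a ℕ.≤ b → ⟦ a ⟧ ≤ ⟦ b ⟧
⟦⟧-mono-≤ {a} {b} a≤b = begin
    ⟦ a ⟧                ≡⟨ +-identityʳ ⟦ a ⟧ ⟨
    ⟦ a ⟧ + 0ℚ           ≤⟨ +-monoʳ-≤ ⟦ a ⟧ (⟦⟧-nonNeg (b ℕ.∸ a)) ⟩
    ⟦ a ⟧ + ⟦ b ℕ.∸ a ⟧  ≡⟨ ⟦+⟧ a (b ℕ.∸ a) ⟨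
    ⟦ a ℕ.+ (b ℕ.∸ a) ⟧  ≡⟨ cong ⟦_⟧ (ℕP.m+[n∸m]≡n a≤b) ⟩
    ⟦ b ⟧                ∎
  where open ≤-Reasoning

⟦⟧-mono-affine : ∀ a z r m → a ℕ.≤ z ℕ.+ r ℕ.* m → ⟦ a ⟧ ≤ ⟦ z ⟧ + ⟦ r ⟧ * ⟦ m ⟧
⟦⟧-mono-affine a z r m h =
  subst (⟦ a ⟧ ≤_) (trans (⟦+⟧ z (r ℕ.* m)) (cong (λ w → ⟦ z ⟧ + w) (⟦*⟧ r m))) (⟦⟧-mono-≤ h)

⟦⟧-mono-+ : ∀ a b c e → a ℕ.+ b ℕ.≤ c ℕ.+ e → ⟦ a ⟧ + ⟦ b ⟧ ≤ ⟦ c ⟧ + ⟦ e ⟧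
⟦⟧-mono-+ a b c e h = subst₂ _≤_ (⟦+⟧ a b) (⟦+⟧ c e) (⟦⟧-mono-≤ h)

⟦⟧-mono-* : ∀ r m a → r ℕ.* m ℕ.≤ a → ⟦ r ⟧ * ⟦ m ⟧ ≤ ⟦ a ⟧
⟦⟧-mono-* r m a h = subst (_≤ ⟦ a ⟧) (⟦*⟧ r m) (⟦⟧-mono-≤ h)

∧-true⁻ : ∀ {a b} → a ∧ b ≡ true → a ≡ true × b ≡ true
∧-true⁻ {true} b≡true = refl , b≡true

does-true⁻ : ∀ {A : Set} (a? : Dec A) → does a? ≡ true → A
does-true⁻ (yes a) _  = a
does-true⁻ (no _)  ()

ind : Bool → ℕ
ind true  = 1
ind false = 0

count : ∀ {n} → (Fin n → Bool) → ℕ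
count P = sum (λ x → ind (P x))

sumFin≡sum : ∀ {n} (f : Fin n → ℕ) → sumFin f ≡ sum f
sumFin≡sum {zero}  f = refl
sumFin≡sum {suc n} f = cong (f Fin.zero ℕ.+_) (sumFin≡sum (λ x → f (Fin.suc x)))

sum-mono-≤ : ∀ {n} {f g : Fin n → ℕ} → (∀ x → f x ℕ.≤ g x) → sum f ℕ.≤ sum g
sum-mono-≤ {zero}  f≤g = ℕ.z≤n
sum-mono-≤ {suc n} f≤g = ℕP.+-mono-≤ (f≤g Fin.zero) (sum-mono-≤ (λ x → f≤g (Fin.suc x)))

count-mono : ∀ {n} {P Q : Fin n → Bool} → (∀ x → P x ≡ true → Q x ≡ true) → count P ℕ.≤ count Q
count-mono {P = P} {Q} P⇒Q = sum-mono-≤ ind-mono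
  where
  ind-mono : ∀ x → ind (P x) ℕ.≤ ind (Q x)
  ind-mono x with P x in p | Q x in q
  ... | false | _     = ℕ.z≤n
  ... | true  | true  = ℕP.≤-refl
  ... | true  | false with () ← trans (sym q) (P⇒Q x p)

count-all : ∀ {n} → count {n} (λ _ → true) ≡ n
count-all {zero}  = refl
count-all {suc n} = cong suc (count-all {n})

summand≤sum : ∀ {n} (f : Fin (suc n) → ℕ) x → f x ℕ.≤ sum f
summand≤sum f x = ℕP.≤-trans (ℕP.m≤m+n (f x) _) (ℕP.≤-reflexive (sym (sum-remove {i = x} f)))

count-pos : ∀ {n} (P : Fin n → Bool) x → P x ≡ true → 1 ℕ.≤ count P
count-pos {suc n} P x Px = subst (ℕ._≤ count P) (cong ind Px) (summand≤sum (λ y → ind (P y)) x)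

count-witness : ∀ {n} (P : Fin n → Bool) → 1 ℕ.≤ count P → ∃ λ x → P x ≡ true
count-witness {suc n} P pos with P Fin.zero in p0
... | true  = Fin.zero , p0
... | false with count-witness (λ x → P (Fin.suc x)) pos
...   | x , Px = Fin.suc x , Px

∣∣≡count : ∀ {n} (S : Subset n) → ∣ S ∣ ≡ count (lookup S)
∣∣≡count []          = refl
∣∣≡count (true ∷ S)  = cong suc (∣∣≡count S)
∣∣≡count (false ∷ S) = ∣∣≡count S

∣tabulate∣ : ∀ {n} (P : Fin n → Bool) → ∣ tabulate P ∣ ≡ count P
∣tabulate∣ P = trans (∣∣≡count (tabulate P)) (sum-cong-≗ (λ x → cong ind (lookup∘tabulate P x)))

∣∩tabulate∣ : ∀ {n} (S : Subset n) (P : Fin n → Bool) → ∣ S ∩ tabulate P ∣ ≡ count (λ x → lookup S x ∧ P x)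
∣∩tabulate∣ S P = trans (∣∣≡count (S ∩ tabulate P)) (sum-cong-≗ λ x →
  cong ind (trans (lookup-zipWith _∧_ x S (tabulate P)) (cong (lookup S x ∧_) (lookup∘tabulate P x))))

sum-select : ∀ {l} (i : Fin l) (a : Fin l → ℕ) → sum (λ j → ind (does (i ≟ j)) ℕ.* a j) ≡ a i
sum-select {suc l} Fin.zero    a = trans (cong₂ ℕ._+_ (ℕP.*-identityˡ (a Fin.zero)) (sum-replicate-zero l)) (ℕP.+-identityʳ _)
sum-select {suc l} (Fin.suc i) a = sum-select i (λ j → a (Fin.suc j))

count-fibres : ∀ {n l} (f : Fin n → Fin l) (Q : Fin l → Bool) →
  count (λ x → Q (f x)) ≡ sum (λ j → count (λ x → does (f x ≟ j)) ℕ.* ind (Q j))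
count-fibres f Q = begin
    count (λ x → Q (f x))
      ≡⟨ sum-cong-≗ (λ x → sym (sum-select (f x) (λ j → ind (Q j)))) ⟩
    sum (λ x → sum (λ j → ind (does (f x ≟ j)) ℕ.* ind (Q j)))
      ≡⟨ ∑-comm (λ x j → ind (does (f x ≟ j)) ℕ.* ind (Q j)) ⟩
    sum (λ j → sum (λ x → ind (does (f x ≟ j)) ℕ.* ind (Q j)))
      ≡⟨ sum-cong-≗ (λ j → sym (*-distribʳ-sum (ind (Q j)) (λ x → ind (does (f x ≟ j))))) ⟩
    sum (λ j → count (λ x → does (f x ≟ j)) ℕ.* ind (Q j))
      ∎
  where open ≡-Reasoning

module ClusterCounting {n k : ℕ} (part : Fin n → Fin (suc k)) (m : ℕ)
                       (equal : ∀ j → ∣ cluster part j ∣ ≡ m) where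

  count-classes : ∀ (Q : Fin (suc k) → Bool) →
    count (λ x → Q (part x)) ≡ ind (Q Fin.zero) ℕ.* ∣ class part Fin.zero ∣ ℕ.+ count (λ j → Q (Fin.suc j)) ℕ.* m
  count-classes Q = begin
      count (λ x → Q (part x))
        ≡⟨ count-fibres part Q ⟩
      fibre Fin.zero ℕ.* ind (Q Fin.zero) ℕ.+ sum (λ j → fibre (Fin.suc j) ℕ.* ind (Q (Fin.suc j)))
        ≡⟨ cong₂ ℕ._+_ (ℕP.*-comm (fibre Fin.zero) _) (sum-cong-≗ cluster-term) ⟩
      ind (Q Fin.zero) ℕ.* fibre Fin.zero ℕ.+ sum (λ j → ind (Q (Fin.suc j)) ℕ.* m)
        ≡⟨ cong₂ (λ a b → ind (Q Fin.zero) ℕ.* a ℕ.+ b) (sym (∣tabulate∣ (λ x → does (part x ≟ Fin.zero))))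
                 (sym (*-distribʳ-sum m (λ j → ind (Q (Fin.suc j))))) ⟩
      ind (Q Fin.zero) ℕ.* ∣ class part Fin.zero ∣ ℕ.+ count (λ j → Q (Fin.suc j)) ℕ.* m
        ∎
    where
    open ≡-Reasoning
    fibre : Fin (suc k) → ℕ
    fibre i = count (λ x → does (part x ≟ i))
    cluster-term : ∀ j → fibre (Fin.suc j) ℕ.* ind (Q (Fin.suc j)) ≡ ind (Q (Fin.suc j)) ℕ.* m
    cluster-term j =
      trans (cong (ℕ._* _) (trans (sym (∣tabulate∣ (λ x → does (part x ≟ Fin.suc j)))) (equal j))) (ℕP.*-comm m _)

  total : n ≡ ∣ class part Fin.zero ∣ ℕ.+ k ℕ.* m
  total = begin
      n                                                       ≡⟨ count-all {n} ⟨
      count {n} (λ _ → true)                                  ≡⟨ count-classes (λ _ → true) ⟩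
      1 ℕ.* ∣ class part Fin.zero ∣ ℕ.+ count {k} (λ _ → true) ℕ.* m
                                                              ≡⟨ cong₂ ℕ._+_ (ℕP.*-identityˡ _) (cong (ℕ._* m) (count-all {k})) ⟩
      ∣ class part Fin.zero ∣ ℕ.+ k ℕ.* m                   ∎
    where open ≡-Reasoning

  count-upper : ∀ (P : Fin n → Bool) (Q : Fin k → Bool) →
    (∀ x j → part x ≡ Fin.suc j → P x ≡ true → Q j ≡ true) →
    count P ℕ.≤ ∣ class part Fin.zero ∣ ℕ.+ count Q ℕ.* m
  count-upper P Q P⇒Q = begin
      count P                                                  ≤⟨ count-mono P⇒class ⟩
      count (λ x → (true Vector.∷ Q) (part x))                ≡⟨ count-classes (true Vector.∷ Q) ⟩
      1 ℕ.* ∣ class part Fin.zero ∣ ℕ.+ count Q ℕ.* m          ≡⟨ cong (ℕ._+ count Q ℕ.* m) (ℕP.*-identityˡ _) ⟩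
      ∣ class part Fin.zero ∣ ℕ.+ count Q ℕ.* m                ∎
    where
    open ℕP.≤-Reasoning
    P⇒class : ∀ x → P x ≡ true → (true Vector.∷ Q) (part x) ≡ true
    P⇒class x Px with part x in px
    ... | Fin.zero  = refl
    ... | Fin.suc j = P⇒Q x j px Px

  count-lower : ∀ (P : Fin n → Bool) (Q : Fin k → Bool) →
    (∀ x j → part x ≡ Fin.suc j → Q j ≡ true → P x ≡ true) →
    count Q ℕ.* m ℕ.≤ count P
  count-lower P Q Q⇒P = begin
      count Q ℕ.* m                               ≡⟨ count-classes (false Vector.∷ Q) ⟨
      count (λ x → (false Vector.∷ Q) (part x))   ≤⟨ count-mono class⇒P ⟩
      count P                                     ∎
    where
    open ℕP.≤-Reasoning
    class⇒P : ∀ x → (false Vector.∷ Q) (part x) ≡ true → P x ≡ true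
    class⇒P x inQ with part x in px
    ... | Fin.suc j = Q⇒P x j px inQ

  in-blow-up : Subset k → Fin n → Bool
  in-blow-up S x = (false Vector.∷ lookup S) (part x)

  blow-up : Subset k → Subset n
  blow-up S = tabulate (in-blow-up S)

  blow-up-lower : ∀ S → ∣ S ∣ ℕ.* m ℕ.≤ ∣ blow-up S ∣
  blow-up-lower S = subst₂ (λ a b → a ℕ.* m ℕ.≤ b) (sym (∣∣≡count S)) (sym (∣tabulate∣ (in-blow-up S)))
    (count-lower (in-blow-up S) (lookup S) (λ x j px j∈S → trans (cong (false Vector.∷ lookup S) px) j∈S))

  blow-up-upper : ∀ S → ∣ blow-up S ∣ ℕ.≤ ∣ class part Fin.zero ∣ ℕ.+ ∣ S ∣ ℕ.* m
  blow-up-upper S =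
    subst₂ (λ a b → a ℕ.≤ ∣ class part Fin.zero ∣ ℕ.+ b ℕ.* m) (sym (∣tabulate∣ (in-blow-up S))) (sym (∣∣≡count S))
    (count-upper (in-blow-up S) (lookup S) (λ x j px x∈S' → trans (cong (false Vector.∷ lookup S) (sym px)) x∈S'))

RN⁺-member : ∀ {n} ν (G : Digraph n) S y → lookup (RN⁺ ν G S) y ≡ true → ν * ⟦ n ⟧ ≤ ⟦ ∣ S ∩ N⁻ G y ∣ ⟧
RN⁺-member {n} ν G S y y∈RN = does-true⁻ (ν * ⟦ n ⟧ ≤? ⟦ ∣ S ∩ N⁻ G y ∣ ⟧)
  (trans (sym (lookup∘tabulate (λ y → does (ν * ⟦ n ⟧ ≤? ⟦ ∣ S ∩ N⁻ G y ∣ ⟧)) y)) y∈RN)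

RN⁺-intro : ∀ {n} ν (G : Digraph n) S y → ν * ⟦ n ⟧ ≤ ⟦ ∣ S ∩ N⁻ G y ∣ ⟧ → lookup (RN⁺ ν G S) y ≡ true
RN⁺-intro {n} ν G S y many = trans (lookup∘tabulate (λ y → does (ν * ⟦ n ⟧ ≤? ⟦ ∣ S ∩ N⁻ G y ∣ ⟧)) y)
  (dec-true (ν * ⟦ n ⟧ ≤? ⟦ ∣ S ∩ N⁻ G y ∣ ⟧) many)

edges-pos : ∀ {n} (G : Digraph n) X Y x y → lookup X x ≡ true → lookup Y y ≡ true → adj G x y ≡ true →
  1 ℕ.≤ edges G X Y
edges-pos {suc n} G X Y x y x∈X y∈Y xy = begin
    1                                          ≤⟨ count-pos (λ z → lookup Y z ∧ adj G x z) y (cong₂ _∧_ y∈Y xy) ⟩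
    count (λ z → lookup Y z ∧ adj G x z)       ≡⟨ ∣∩tabulate∣ Y (adj G x) ⟨
    ∣ Y ∩ N⁺ G x ∣                             ≡⟨ cong (λ b → if b then ∣ Y ∩ N⁺ G x ∣ else 0) x∈X ⟨
    out-edges x                                ≤⟨ summand≤sum out-edges x ⟩
    sum out-edges                              ≡⟨ sumFin≡sum out-edges ⟨
    edges G X Y                                ∎
  where
  open ℕP.≤-Reasoning
  out-edges : Fin (suc n) → ℕ
  out-edges z = if lookup X z then ∣ Y ∩ N⁺ G z ∣ else 0

ratio-nonzero : ∀ e p → 1 ℕ.≤ e → 1 ℕ.≤ p → ratio e p ≢ 0ℚ
ratio-nonzero (suc e) (suc p) _ _ ratio≡0 = <-irrefl (sym ratio≡0) (positive⁻¹ _ {{normalize-pos (suc e) (suc p)}})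

reduced-adj : ∀ {n k} ε d (G' : Digraph n) (part : Fin n → Fin (suc k)) i j → i ≢ j →
  Regular ε G' (cluster part i) (cluster part j) → d ≤ density G' (cluster part i) (cluster part j) →
  adj (reduced ε d G' part) i j ≡ true
reduced-adj ε d G' part i j i≢j reg dense =
  cong₂ _∧_ (cong not (dec-false (i ≟ j) i≢j))
            (cong₂ _∧_ (dec-true (regular? ε G' (cluster part i) (cluster part j)) reg)
                       (dec-true (d ≤? density G' (cluster part i) (cluster part j)) dense))

in-cluster : ∀ {n k} (part : Fin n → Fin (suc k)) {x i} → part x ≡ Fin.suc i → lookup (cluster part i) x ≡ true
in-cluster part {x} {i} px = trans (lookup∘tabulate (λ y → does (part y ≟ Fin.suc i)) x) (dec-true (part x ≟ Fin.suc i) px)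

cluster-nonempty : ∀ {n k} (part : Fin n → Fin (suc k)) {x i} → part x ≡ Fin.suc i → 1 ℕ.≤ ∣ cluster part i ∣
cluster-nonempty part {x} {i} px =
  subst (1 ℕ.≤_) (sym (∣∣≡count (cluster part i))) (count-pos (lookup (cluster part i)) x (in-cluster part px))

edge-in-reduced : ∀ {n k} ε d (G' : Digraph n) (part : Fin n → Fin (suc k)) →
  (∀ i → edges G' (cluster part i) (cluster part i) ≡ 0) →
  (∀ i j → i ≢ j → Regular ε G' (cluster part i) (cluster part j)
                   × (density G' (cluster part i) (cluster part j) ≡ 0ℚ ⊎ d ≤ density G' (cluster part i) (cluster part j))) →
  ∀ {x y i j} → part x ≡ Fin.suc i → part y ≡ Fin.suc j → adj G' x y ≡ true → adj (reduced ε d G' part) i j ≡ true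
edge-in-reduced ε d G' part no-internal dichotomy {x} {y} {i} {j} px py xy = by-cases (i ≟ j)
  where
  edge-between : 1 ℕ.≤ edges G' (cluster part i) (cluster part j)
  edge-between = edges-pos G' (cluster part i) (cluster part j) x y (in-cluster part px) (in-cluster part py) xy
  from-dichotomy : i ≢ j → Regular ε G' (cluster part i) (cluster part j)
    × (density G' (cluster part i) (cluster part j) ≡ 0ℚ ⊎ d ≤ density G' (cluster part i) (cluster part j)) →
    adj (reduced ε d G' part) i j ≡ true
  from-dichotomy i≢j (reg , inj₂ dense) = reduced-adj ε d G' part i j i≢j reg dense
  from-dichotomy i≢j (reg , inj₁ empty) = contradiction empty
    (ratio-nonzero _ _ edge-between (ℕP.*-mono-≤ (cluster-nonempty part px) (cluster-nonempty part py)))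
  by-cases : Dec (i ≡ j) → adj (reduced ε d G' part) i j ≡ true
  by-cases (yes i≡j) = contradiction
    (subst (1 ℕ.≤_) (no-internal i)
      (subst (λ l → 1 ℕ.≤ edges G' (cluster part i) (cluster part l)) (sym i≡j) edge-between))
    (λ ())
  by-cases (no i≢j) = from-dichotomy i≢j (dichotomy i j i≢j)

lost-inneighbours : ∀ {n} (G' G : Digraph n) → SubDigraph G' G → ∀ S y →
  ∣ S ∩ N⁻ G y ∣ ℕ.+ indeg G' y ℕ.≤ ∣ S ∩ N⁻ G' y ∣ ℕ.+ indeg G y
lost-inneighbours G' G G'⊆G S y = begin
    ∣ S ∩ N⁻ G y ∣ ℕ.+ indeg G' y
      ≡⟨ cong₂ ℕ._+_ (∣∩tabulate∣ S (λ x → adj G x y)) (∣tabulate∣ (λ x → adj G' x y)) ⟩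
    count (λ x → lookup S x ∧ adj G x y) ℕ.+ count (λ x → adj G' x y)
      ≡⟨ ∑-distrib-+ (λ x → ind (lookup S x ∧ adj G x y)) (λ x → ind (adj G' x y)) ⟨
    sum (λ x → ind (lookup S x ∧ adj G x y) ℕ.+ ind (adj G' x y))
      ≤⟨ sum-mono-≤ (λ x → pointwise (lookup S x) (adj G x y) (adj G' x y) (G'⊆G x y)) ⟩
    sum (λ x → ind (lookup S x ∧ adj G' x y) ℕ.+ ind (adj G x y))
      ≡⟨ ∑-distrib-+ (λ x → ind (lookup S x ∧ adj G' x y)) (λ x → ind (adj G x y)) ⟩
    count (λ x → lookup S x ∧ adj G' x y) ℕ.+ count (λ x → adj G x y)
      ≡⟨ cong₂ ℕ._+_ (∣∩tabulate∣ S (λ x → adj G' x y)) (∣tabulate∣ (λ x → adj G x y)) ⟨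
    ∣ S ∩ N⁻ G' y ∣ ℕ.+ indeg G y
      ∎
  where
  open ℕP.≤-Reasoning
  pointwise : ∀ s g g' → (g' ≡ true → g ≡ true) → ind (s ∧ g) ℕ.+ ind g' ℕ.≤ ind (s ∧ g') ℕ.+ ind g
  pointwise false g     false _    = ℕ.z≤n
  pointwise true  g     false _    = ℕP.≤-reflexive (ℕP.+-comm (ind g) 0)
  pointwise s     false true  g'⇒g with () ← g'⇒g refl
  pointwise false true  true  _    = ℕP.≤-refl
  pointwise true  true  true  _    = ℕP.≤-refl

module DegreeTransfer {n k : ℕ} (part : Fin n → Fin (suc k)) (m : ℕ)
  (equal : ∀ j → ∣ cluster part j ∣ ≡ m) (G' : Digraph n) (R : Digraph k)
  (covers : ∀ {x y i j} → part x ≡ Fin.suc i → part y ≡ Fin.suc j → adj G' x y ≡ true → adj R i j ≡ true) where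

  open ClusterCounting part m equal

  outdeg-transfer : ∀ {x i} → part x ≡ Fin.suc i → outdeg G' x ℕ.≤ ∣ class part Fin.zero ∣ ℕ.+ outdeg R i ℕ.* m
  outdeg-transfer {x} {i} px =
    subst₂ (λ a b → a ℕ.≤ ∣ class part Fin.zero ∣ ℕ.+ b ℕ.* m) (sym (∣tabulate∣ (adj G' x))) (sym (∣tabulate∣ (adj R i)))
      (count-upper (adj G' x) (adj R i) (λ y j py xy → covers px py xy))

  indeg-transfer : ∀ {x i} → part x ≡ Fin.suc i → indeg G' x ℕ.≤ ∣ class part Fin.zero ∣ ℕ.+ indeg R i ℕ.* m
  indeg-transfer {x} {i} px =
    subst₂ (λ a b → a ℕ.≤ ∣ class part Fin.zero ∣ ℕ.+ b ℕ.* m)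
      (sym (∣tabulate∣ (λ y → adj G' y x))) (sym (∣tabulate∣ (λ j → adj R j i)))
      (count-upper (λ y → adj G' y x) (λ j → adj R j i) (λ y j py yx → covers py px yx))

  inneighbours-in-blow-up : ∀ S {y j} → part y ≡ Fin.suc j →
    ∣ blow-up S ∩ N⁻ G' y ∣ ℕ.≤ ∣ class part Fin.zero ∣ ℕ.+ ∣ S ∩ N⁻ R j ∣ ℕ.* m
  inneighbours-in-blow-up S {y} {j} py =
    subst₂ (λ a b → a ℕ.≤ ∣ class part Fin.zero ∣ ℕ.+ b ℕ.* m)
      (sym (∣∩tabulate∣ (blow-up S) (λ x → adj G' x y))) (sym (∣∩tabulate∣ S (λ i → adj R i j)))
      (count-upper (λ x → lookup (blow-up S) x ∧ adj G' x y) (λ i → lookup S i ∧ adj R i j) covered)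
    where
    covered : ∀ x i → part x ≡ Fin.suc i → lookup (blow-up S) x ∧ adj G' x y ≡ true → lookup S i ∧ adj R i j ≡ true
    covered x i px x∈S'∧xy with ∧-true⁻ x∈S'∧xy
    ... | x∈S' , xy = cong₂ _∧_ i∈S (covers px py xy)
      where
      i∈S : lookup S i ≡ true
      i∈S = trans (sym (trans (lookup∘tabulate (in-blow-up S) x) (cong (false Vector.∷ lookup S) px))) x∈S'

*ʳ-mono-≤ : ∀ {p q} r → 0ℚ ≤ r → p ≤ q → p * r ≤ q * r
*ʳ-mono-≤ r 0≤r = *-monoʳ-≤-nonNeg r {{nonNegative 0≤r}}

*ˡ-mono-≤ : ∀ {p q} r → 0ℚ ≤ r → p ≤ q → r * p ≤ r * q
*ˡ-mono-≤ r 0≤r = *-monoˡ-≤-nonNeg r {{nonNegative 0≤r}}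

*ʳ-mono-< : ∀ {p q} r → 0ℚ < r → p < q → p * r < q * r
*ʳ-mono-< r 0<r = *-monoˡ-<-pos r {{positive 0<r}}

*ʳ-cancel-< : ∀ {p q} r → 0ℚ ≤ r → p * r < q * r → p < q
*ʳ-cancel-< r 0≤r = *-cancelʳ-<-nonNeg r {{nonNegative 0≤r}}

*ʳ-cancel-≤ : ∀ {p q} r → 0ℚ < r → p * r ≤ q * r → p ≤ q
*ʳ-cancel-≤ r 0<r = *-cancelʳ-≤-pos r {{positive 0<r}}

*-nonNeg : ∀ {p q} → 0ℚ ≤ p → 0ℚ ≤ q → 0ℚ ≤ p * q
*-nonNeg {p} {q} 0≤p 0≤q = subst (_≤ p * q) (*-zeroˡ q) (*ʳ-mono-≤ q 0≤q 0≤p)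

p+r-r≡p : ∀ p r → p + r - r ≡ p
p+r-r≡p = solve 2 (λ p r → p :+ r :- r := p) refl

+ʳ-cancel-< : ∀ {p q} r → p + r < q + r → p < q
+ʳ-cancel-< {p} {q} r p+r<q+r = subst₂ _<_ (p+r-r≡p p r) (p+r-r≡p q r) (+-monoˡ-< (- r) p+r<q+r)

+ʳ-cancel-≤ : ∀ {p q} r → p + r ≤ q + r → p ≤ q
+ʳ-cancel-≤ {p} {q} r p+r≤q+r = subst₂ _≤_ (p+r-r≡p p r) (p+r-r≡p q r) (+-monoˡ-≤ (- r) p+r≤q+r)

-<⇒<+ : ∀ {p q r} → p - q < r → p < r + q
-<⇒<+ {p} {q} {r} p-q<r = subst (_< r + q) (solve 2 (λ p q → p :- q :+ q := p) refl p q) (+-monoˡ-< q p-q<r)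

0≤½ : 0ℚ ≤ ½
0≤½ = ≤ᵇ⇒≤ tt

⟦⟧-pos : ∀ {a} → 1 ℕ.≤ a → 0ℚ < ⟦ a ⟧
⟦⟧-pos {suc a} _ = positive⁻¹ ⟦ suc a ⟧ {{normalize-pos (suc a) 1}}

restricted-loss : ∀ a b I I' δ → a + I' ≤ b + I → I - δ < I' → a - δ < b
restricted-loss a b I I' δ lost total = +ʳ-cancel-< I' (begin-strict
    a - δ + I'      ≡⟨ solve 3 (λ a δ I' → a :- δ :+ I' := (a :+ I') :- δ) refl a δ I' ⟩
    (a + I') - δ    ≤⟨ +-monoˡ-≤ (- δ) lost ⟩
    (b + I) - δ     ≡⟨ solve 3 (λ b I δ → (b :+ I) :- δ := b :+ (I :- δ)) refl b I δ ⟩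
    b + (I - δ)     <⟨ +-monoʳ-< b total ⟩
    b + I'          ∎)
  where open ≤-Reasoning

-- The rational quantities N = n, K = k, M = m, Z = |V₀| of a partition into
-- V₀ and k clusters of size m, with |V₀| ≤ εn.
module PartitionArithmetic (ε N K M Z : ℚ) (0≤N : 0ℚ ≤ N) (0<M : 0ℚ < M)
  (N≡Z+KM : N ≡ Z + K * M) (Z≤εN : Z ≤ ε * N) (KM≤N : K * M ≤ N) where

  covered-neighbours : ∀ θ d r {a b} → θ * N ≤ a → a - (d + ε) * N < b → b ≤ Z + r * M →
    θ * N < r * M + (d + (ε + ε)) * N
  covered-neighbours θ d r {a} {b} θN≤a kept b≤Z+rM = begin-strict
    θ * N                          ≤⟨ θN≤a ⟩
    a                              <⟨ -<⇒<+ kept ⟩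
    b + (d + ε) * N                ≤⟨ +-monoˡ-≤ ((d + ε) * N) (≤-trans b≤Z+rM (+-monoˡ-≤ (r * M) Z≤εN)) ⟩
    (ε * N + r * M) + (d + ε) * N  ≡⟨ solve 5 (λ ε N r M d → (ε :* N :+ r :* M) :+ (d :+ ε) :* N
                                                            := r :* M :+ (d :+ (ε :+ ε)) :* N) refl ε N r M d ⟩
    r * M + (d + (ε + ε)) * N      ∎
    where open ≤-Reasoning

  clusters-needed : ∀ θ δ r → 0ℚ ≤ θ → δ ≤ θ * ½ → θ * N < r * M + δ * N → θ * K * ½ ≤ r
  clusters-needed θ δ r 0≤θ δ≤θ/2 θN< =
    <⇒≤ (*ʳ-cancel-< M (<⇒≤ 0<M) (+ʳ-cancel-< (δ * N) (≤-<-trans bound θN<)))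
    where
    open ≤-Reasoning
    bound : θ * K * ½ * M + δ * N ≤ θ * N
    bound = begin
      θ * K * ½ * M + δ * N    ≡⟨ cong (_+ δ * N) (solve 4 (λ θ K h M → θ :* K :* h :* M := θ :* h :* (K :* M)) refl θ K ½ M) ⟩
      θ * ½ * (K * M) + δ * N  ≤⟨ +-mono-≤ (*ˡ-mono-≤ (θ * ½) (*-nonNeg 0≤θ 0≤½) KM≤N) (*ʳ-mono-≤ N 0≤N δ≤θ/2) ⟩
      θ * ½ * N + θ * ½ * N    ≡⟨ solve 2 (λ θ N → θ :* con ½ :* N :+ θ :* con ½ :* N := θ :* N) refl θ N ⟩
      θ * N                    ∎

  reduced-degree : ∀ θ d r {a b} → 0ℚ ≤ θ → d + (ε + ε) ≤ θ * ½ →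
    θ * N ≤ a → a - (d + ε) * N < b → b ≤ Z + r * M → θ * K * ½ ≤ r
  reduced-degree θ d r 0≤θ small θN≤a kept covered =
    clusters-needed θ (d + (ε + ε)) r 0≤θ small (covered-neighbours θ d r θN≤a kept covered)

  N≤2KM : ε + ε ≤ 1ℚ → N ≤ ⟦ 2 ⟧ * (K * M)
  N≤2KM 2ε≤1 = +ʳ-cancel-≤ N (begin
    N + N                        ≡⟨ cong₂ _+_ N≡Z+KM N≡Z+KM ⟩
    (Z + K * M) + (Z + K * M)    ≡⟨ solve 2 (λ Z KM → (Z :+ KM) :+ (Z :+ KM) := (Z :+ Z) :+ con ⟦ 2 ⟧ :* KM) refl Z (K * M) ⟩
    (Z + Z) + ⟦ 2 ⟧ * (K * M)    ≤⟨ +-monoˡ-≤ (⟦ 2 ⟧ * (K * M)) (+-mono-≤ Z≤εN Z≤εN) ⟩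
    (ε * N + ε * N) + ⟦ 2 ⟧ * (K * M) ≡⟨ cong (_+ ⟦ 2 ⟧ * (K * M)) (*-distribʳ-+ N ε ε) ⟨
    (ε + ε) * N + ⟦ 2 ⟧ * (K * M) ≤⟨ +-monoˡ-≤ (⟦ 2 ⟧ * (K * M)) (*ʳ-mono-≤ N 0≤N 2ε≤1) ⟩
    1ℚ * N + ⟦ 2 ⟧ * (K * M)     ≡⟨ solve 2 (λ N KM → con 1ℚ :* N :+ con ⟦ 2 ⟧ :* KM := con ⟦ 2 ⟧ :* KM :+ N) refl N (K * M) ⟩
    ⟦ 2 ⟧ * (K * M) + N          ∎)
    where open ≤-Reasoning

  blow-up-in-range : ∀ τ {s s'} → 0ℚ ≤ τ → ε + ε ≤ 1ℚ →
    ⟦ 2 ⟧ * τ * K < s → s < (⟦ 1 ⟧ - ⟦ 2 ⟧ * τ) * K → s * M ≤ s' → s' ≤ Z + s * M →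
    τ * N < s' × s' < (⟦ 1 ⟧ - τ) * N
  blow-up-in-range τ {s} {s'} 0≤τ 2ε≤1 lower upper sM≤s' s'≤Z+sM = above , below
    where
    open ≤-Reasoning
    τN≤2τKM : τ * N ≤ ⟦ 2 ⟧ * τ * K * M
    τN≤2τKM = begin
      τ * N                   ≤⟨ *ˡ-mono-≤ τ 0≤τ (N≤2KM 2ε≤1) ⟩
      τ * (⟦ 2 ⟧ * (K * M))   ≡⟨ solve 3 (λ τ K M → τ :* (con ⟦ 2 ⟧ :* (K :* M)) := con ⟦ 2 ⟧ :* τ :* K :* M) refl τ K M ⟩
      ⟦ 2 ⟧ * τ * K * M       ∎
    above : τ * N < s'
    above = begin-strict
      τ * N                   ≤⟨ τN≤2τKM ⟩
      ⟦ 2 ⟧ * τ * K * M       <⟨ *ʳ-mono-< M 0<M lower ⟩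
      s * M                   ≤⟨ sM≤s' ⟩
      s'                      ∎
    below : s' < (⟦ 1 ⟧ - τ) * N
    below = +ʳ-cancel-< (τ * N) (begin-strict
      s' + τ * N                                  ≤⟨ +-mono-≤ s'≤Z+sM τN≤2τKM ⟩
      Z + s * M + ⟦ 2 ⟧ * τ * K * M               <⟨ +-monoˡ-< (⟦ 2 ⟧ * τ * K * M) (+-monoʳ-< Z (*ʳ-mono-< M 0<M upper)) ⟩
      Z + (⟦ 1 ⟧ - ⟦ 2 ⟧ * τ) * K * M + ⟦ 2 ⟧ * τ * K * M
        ≡⟨ solve 4 (λ Z τ K M → Z :+ (con ⟦ 1 ⟧ :- con ⟦ 2 ⟧ :* τ) :* K :* M :+ con ⟦ 2 ⟧ :* τ :* K :* M
                                 := Z :+ K :* M) refl Z τ K M ⟩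
      Z + K * M                                   ≡⟨ N≡Z+KM ⟨
      N                                           ≡⟨ solve 2 (λ τ N → N := (con ⟦ 1 ⟧ :- τ) :* N :+ τ :* N) refl τ N ⟩
      (⟦ 1 ⟧ - τ) * N + τ * N                     ∎)

  expansion-transfer : ∀ ν s r {s' t} → 0ℚ ≤ ν → ε ≤ ν * ½ →
    s * M ≤ s' → s' + ν * N ≤ t → t ≤ Z + r * M → s + ν * ½ * K ≤ r
  expansion-transfer ν s r {s'} {t} 0≤ν ε≤ν/2 sM≤s' expands covered =
    *ʳ-cancel-≤ M 0<M (≤-trans scaled (+ʳ-cancel-≤ (ν * ½ * N) rM-bound))
    where
    open ≤-Reasoning
    scaled : (s + ν * ½ * K) * M ≤ s' + ν * ½ * N
    scaled = begin
      (s + ν * ½ * K) * M        ≡⟨ solve 5 (λ s ν h K M → (s :+ ν :* h :* K) :* M := s :* M :+ ν :* h :* (K :* M)) refl s ν ½ K M ⟩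
      s * M + ν * ½ * (K * M)    ≤⟨ +-mono-≤ sM≤s' (*ˡ-mono-≤ (ν * ½) (*-nonNeg 0≤ν 0≤½) KM≤N) ⟩
      s' + ν * ½ * N             ∎
    rM-bound : (s' + ν * ½ * N) + ν * ½ * N ≤ r * M + ν * ½ * N
    rM-bound = begin
      (s' + ν * ½ * N) + ν * ½ * N  ≡⟨ solve 3 (λ s' ν N → s' :+ ν :* con ½ :* N :+ ν :* con ½ :* N := s' :+ ν :* N) refl s' ν N ⟩
      s' + ν * N                    ≤⟨ ≤-trans expands covered ⟩
      Z + r * M                     ≤⟨ +-monoˡ-≤ (r * M) (≤-trans Z≤εN (*ʳ-mono-≤ N 0≤N ε≤ν/2)) ⟩
      ν * ½ * N + r * M             ≡⟨ +-comm (ν * ½ * N) (r * M) ⟩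
      r * M + ν * ½ * N             ∎

record SmallErrors (ν η d ε : ℚ) : Set where
  field
    for-η : d + (ε + ε) ≤ η * ½
    for-ν : d + (ε + ε) ≤ ν * ½
    ε≤ν/2 : ε ≤ ν * ½
    2ε≤1  : ε + ε ≤ 1ℚ
    ε<1   : ε < 1ℚ

⅛ : ℚ
⅛ = + 1 / 8

⊓-pos : ∀ {p q} → 0ℚ < p → 0ℚ < q → 0ℚ < p ⊓ q
⊓-pos {p} {q} 0<p 0<q with ⊓-sel p q
... | inj₁ p⊓q≡p = subst (0ℚ <_) (sym p⊓q≡p) 0<p
... | inj₂ p⊓q≡q = subst (0ℚ <_) (sym p⊓q≡q) 0<q

-- With d₀ = min(η,ν)/8 and 0 < ε ≤ d ≤ d₀ all smallness conditions hold,
-- since d + 2ε ≤ 3 min(η,ν)/8.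
small-errors : ∀ {ν η d ε} → 0ℚ < η → 0ℚ < ν → ν < 1ℚ → 0ℚ < d → d ≤ (η ⊓ ν) * ⅛ → 0ℚ < ε → ε ≤ d →
  SmallErrors ν η d ε
small-errors {ν} {η} {d} {ε} 0<η 0<ν ν<1 0<d d≤d₀ 0<ε ε≤d = record
  { for-η = error≤ η (p⊓q≤p η ν)
  ; for-ν = error≤ ν (p⊓q≤q η ν)
  ; ε≤ν/2 = ≤-trans ε≤2ε (≤-trans 2ε≤error (error≤ ν (p⊓q≤q η ν)))
  ; 2ε≤1  = 2ε≤1
  ; ε<1   = <-≤-trans ε<2ε 2ε≤1
  }
  where
  open ≤-Reasoning
  μ = η ⊓ ν
  0≤μ : 0ℚ ≤ μ
  0≤μ = <⇒≤ (⊓-pos 0<η 0<ν)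
  error≤ : ∀ θ → μ ≤ θ → d + (ε + ε) ≤ θ * ½
  error≤ θ μ≤θ = begin
    d + (ε + ε)              ≤⟨ +-mono-≤ d≤d₀ (+-mono-≤ ε≤d₀ ε≤d₀) ⟩
    μ * ⅛ + (μ * ⅛ + μ * ⅛)  ≡⟨ solve 1 (λ μ → μ :* con ⅛ :+ (μ :* con ⅛ :+ μ :* con ⅛) := μ :* con (+ 3 / 8)) refl μ ⟩
    μ * (+ 3 / 8)            ≤⟨ *ˡ-mono-≤ μ 0≤μ (≤ᵇ⇒≤ tt) ⟩
    μ * ½                    ≤⟨ *ʳ-mono-≤ ½ 0≤½ μ≤θ ⟩
    θ * ½                    ∎
    where
    ε≤d₀ : ε ≤ μ * ⅛
    ε≤d₀ = ≤-trans ε≤d d≤d₀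
  ε<2ε : ε < ε + ε
  ε<2ε = subst (_< ε + ε) (+-identityʳ ε) (+-monoʳ-< ε 0<ε)
  ε≤2ε : ε ≤ ε + ε
  ε≤2ε = <⇒≤ ε<2ε
  2ε≤error : ε + ε ≤ d + (ε + ε)
  2ε≤error = subst (_≤ d + (ε + ε)) (+-identityˡ (ε + ε)) (+-monoˡ-≤ (ε + ε) (<⇒≤ 0<d))
  2ε≤1 : ε + ε ≤ 1ℚ
  2ε≤1 = begin
    ε + ε         ≤⟨ 2ε≤error ⟩
    d + (ε + ε)   ≤⟨ error≤ ν (p⊓q≤q η ν) ⟩
    ν * ½         ≤⟨ *ʳ-mono-≤ ½ 0≤½ (<⇒≤ ν<1) ⟩
    1ℚ * ½        ≤⟨ ≤ᵇ⇒≤ tt ⟩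
    1ℚ            ∎

module ReducedDigraph
  {ν τ η d ε : ℚ} (0≤ν : 0ℚ ≤ ν) (0≤τ : 0ℚ ≤ τ) (0≤η : 0ℚ ≤ η) (small : SmallErrors ν η d ε)
  {n : ℕ} (1≤n : 1 ℕ.≤ n) (G : Digraph n)
  (G-degree : MinSemiDegAtLeast G (η * ⟦ n ⟧)) (G-expands : RobustOutexpander ν τ G)
  {k : ℕ} (part : Fin n → Fin (suc k)) (G' : Digraph n) (G'⊆G : SubDigraph G' G)
  (V₀-small : ⟦ ∣ class part Fin.zero ∣ ⟧ ≤ ε * ⟦ n ⟧)
  (m : ℕ) (equal : ∀ i → ∣ cluster part i ∣ ≡ m)
  (degree-loss : ∀ x → (⟦ outdeg G x ⟧ - (d + ε) * ⟦ n ⟧ < ⟦ outdeg G' x ⟧)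
                     × (⟦ indeg G x ⟧ - (d + ε) * ⟦ n ⟧ < ⟦ indeg G' x ⟧))
  (no-internal : ∀ i → edges G' (cluster part i) (cluster part i) ≡ 0)
  (dichotomy : ∀ i j → i ≢ j → Regular ε G' (cluster part i) (cluster part j)
                 × (density G' (cluster part i) (cluster part j) ≡ 0ℚ ⊎ d ≤ density G' (cluster part i) (cluster part j)))
  where

  open SmallErrors small

  R : Digraph k
  R = reduced ε d G' part

  open ClusterCounting part m equal
  open DegreeTransfer part m equal G' R (edge-in-reduced ε d G' part no-internal dichotomy)

  z : ℕ
  z = ∣ class part Fin.zero ∣

  -- The clusters are nonempty: otherwise V₀ would be everything, yet |V₀| ≤ εn < n.
  1≤m : 1 ℕ.≤ m
  1≤m = size-pos m total
    where
    open ≤-Reasoning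
    size-pos : ∀ m' → n ≡ z ℕ.+ k ℕ.* m' → 1 ℕ.≤ m'
    size-pos (suc _) _       = ℕ.s≤s ℕ.z≤n
    size-pos zero    n≡z+k*0 = contradiction (begin-strict
        ⟦ n ⟧        ≡⟨ cong ⟦_⟧ (trans n≡z+k*0 (trans (cong (z ℕ.+_) (ℕP.*-zeroʳ k)) (ℕP.+-identityʳ z))) ⟩
        ⟦ z ⟧        ≤⟨ V₀-small ⟩
        ε * ⟦ n ⟧    <⟨ *ʳ-mono-< ⟦ n ⟧ (⟦⟧-pos 1≤n) ε<1 ⟩
        1ℚ * ⟦ n ⟧   ≡⟨ *-identityˡ ⟦ n ⟧ ⟩
        ⟦ n ⟧        ∎) (<-irrefl refl)

  open PartitionArithmetic ε ⟦ n ⟧ ⟦ k ⟧ ⟦ m ⟧ ⟦ z ⟧ (⟦⟧-nonNeg n) (⟦⟧-pos 1≤m)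
    (trans (cong ⟦_⟧ total) (trans (⟦+⟧ z (k ℕ.* m)) (cong (λ w → ⟦ z ⟧ + w) (⟦*⟧ k m))))
    V₀-small
    (⟦⟧-mono-* k m n (subst (k ℕ.* m ℕ.≤_) (sym total) (ℕP.m≤n+m (k ℕ.* m) z)))

  vertex-in : ∀ i → ∃ λ x → part x ≡ Fin.suc i
  vertex-in i with count-witness (lookup (cluster part i)) (subst (1 ℕ.≤_) (trans (sym (equal i)) (∣∣≡count (cluster part i))) 1≤m)
  ... | x , x∈Vᵢ =
    x , does-true⁻ (part x ≟ Fin.suc i) (trans (sym (lookup∘tabulate (λ y → does (part y ≟ Fin.suc i)) x)) x∈Vᵢ)

  -- δ⁰(R) ≥ ηk/2: transfer the degrees of any vertex of the cluster.
  min-semidegree : MinSemiDegAtLeast R (η * ⟦ k ⟧ * ½)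
  min-semidegree i = degrees-at (proj₂ (vertex-in i))
    where
    degrees-at : ∀ {x} → part x ≡ Fin.suc i →
      (η * ⟦ k ⟧ * ½ ≤ ⟦ outdeg R i ⟧) × (η * ⟦ k ⟧ * ½ ≤ ⟦ indeg R i ⟧)
    degrees-at {x} px =
      reduced-degree η d ⟦ outdeg R i ⟧ 0≤η for-η (proj₁ (G-degree x)) (proj₁ (degree-loss x))
        (⟦⟧-mono-affine (outdeg G' x) z (outdeg R i) m (outdeg-transfer px)) ,
      reduced-degree η d ⟦ indeg R i ⟧ 0≤η for-η (proj₂ (G-degree x)) (proj₂ (degree-loss x))
        (⟦⟧-mono-affine (indeg G' x) z (indeg R i) m (indeg-transfer px))

  RN⁺-transfer : ∀ S {y j} → part y ≡ Fin.suc j →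
    lookup (RN⁺ ν G (blow-up S)) y ≡ true → lookup (RN⁺ (ν * ½) R S) j ≡ true
  RN⁺-transfer S {y} {j} py y∈RN = RN⁺-intro (ν * ½) R S j (subst (_≤ ⟦ ∣ S ∩ N⁻ R j ∣ ⟧) reorder
    (reduced-degree ν d ⟦ ∣ S ∩ N⁻ R j ∣ ⟧ 0≤ν for-ν (RN⁺-member ν G S' y y∈RN) kept
      (⟦⟧-mono-affine (∣ S' ∩ N⁻ G' y ∣) z (∣ S ∩ N⁻ R j ∣) m (inneighbours-in-blow-up S py))))
    where
    S' : Subset n
    S' = blow-up S
    reorder : ν * ⟦ k ⟧ * ½ ≡ ν * ½ * ⟦ k ⟧
    reorder = solve 2 (λ ν K → ν :* K :* con ½ := ν :* con ½ :* K) refl ν ⟦ k ⟧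
    kept : ⟦ ∣ S' ∩ N⁻ G y ∣ ⟧ - (d + ε) * ⟦ n ⟧ < ⟦ ∣ S' ∩ N⁻ G' y ∣ ⟧
    kept = restricted-loss ⟦ ∣ S' ∩ N⁻ G y ∣ ⟧ ⟦ ∣ S' ∩ N⁻ G' y ∣ ⟧ ⟦ indeg G y ⟧ ⟦ indeg G' y ⟧ ((d + ε) * ⟦ n ⟧)
      (⟦⟧-mono-+ (∣ S' ∩ N⁻ G y ∣) (indeg G' y) (∣ S' ∩ N⁻ G' y ∣) (indeg G y) (lost-inneighbours G' G G'⊆G S' y))
      (proj₂ (degree-loss y))

  -- R is a robust (ν/2, 2τ)-outexpander: blow S up, expand in G, and count
  -- the clusters met by the expansion.
  robust-expansion : RobustOutexpander (ν * ½) (⟦ 2 ⟧ * τ) R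
  robust-expansion S above below =
    expansion-transfer ν ⟦ ∣ S ∣ ⟧ ⟦ ∣ RN⁺ (ν * ½) R S ∣ ⟧ 0≤ν ε≤ν/2 S-lower
      (G-expands S' (proj₁ in-range) (proj₂ in-range))
      (⟦⟧-mono-affine (∣ RN⁺ ν G S' ∣) z (∣ RN⁺ (ν * ½) R S ∣) m RN⁺-covered)
    where
    S' : Subset n
    S' = blow-up S
    S-lower : ⟦ ∣ S ∣ ⟧ * ⟦ m ⟧ ≤ ⟦ ∣ S' ∣ ⟧
    S-lower = ⟦⟧-mono-* (∣ S ∣) m (∣ S' ∣) (blow-up-lower S)
    in-range : (τ * ⟦ n ⟧ < ⟦ ∣ S' ∣ ⟧) × (⟦ ∣ S' ∣ ⟧ < (⟦ 1 ⟧ - τ) * ⟦ n ⟧)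
    in-range = blow-up-in-range τ 0≤τ 2ε≤1 above below S-lower (⟦⟧-mono-affine (∣ S' ∣) z (∣ S ∣) m (blow-up-upper S))
    RN⁺-covered : ∣ RN⁺ ν G S' ∣ ℕ.≤ z ℕ.+ ∣ RN⁺ (ν * ½) R S ∣ ℕ.* m
    RN⁺-covered = subst₂ (λ a b → a ℕ.≤ z ℕ.+ b ℕ.* m) (sym (∣∣≡count (RN⁺ ν G S'))) (sym (∣∣≡count (RN⁺ (ν * ½) R S)))
      (count-upper (lookup (RN⁺ ν G S')) (lookup (RN⁺ (ν * ½) R S)) (λ y j py → RN⁺-transfer S py))

lemma14 : ∀ (ν τ η : ℚ) → 0ℚ < ν → ν < 1ℚ → 0ℚ < τ → τ < 1ℚ → 0ℚ < η → η < 1ℚ →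
  ∃[ d₀ ] (0ℚ < d₀ × (∀ (d : ℚ) → 0ℚ < d → d ≤ d₀ →
  ∃[ ε₀ ] (0ℚ < ε₀ × (∀ (ε : ℚ) → 0ℚ < ε → ε ≤ ε₀ → ∀ (M' : ℕ) → 1 ℕ.≤ M' →
  ∃[ n₀ ] (∀ (n : ℕ) → n₀ ℕ.≤ n →
    ∀ (G : Digraph n) → MinSemiDegAtLeast G (η * ⟦ n ⟧) → RobustOutexpander ν τ G →
    ∀ (k : ℕ) (part : Fin n → Fin (suc k)) (G' : Digraph n) → SubDigraph G' G →
    M' ℕ.≤ k →
    ⟦ ∣ class part Fin.zero ∣ ⟧ ≤ ε * ⟦ n ⟧ →
    (∃[ m ] (∀ (i : Fin k) → ∣ cluster part i ∣ ≡ m)) →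
    (∀ (x : Fin n) →
       (⟦ outdeg G x ⟧ - (d + ε) * ⟦ n ⟧ < ⟦ outdeg G' x ⟧)
       × (⟦ indeg G x ⟧ - (d + ε) * ⟦ n ⟧ < ⟦ indeg G' x ⟧)) →
    (∀ (i : Fin k) → edges G' (cluster part i) (cluster part i) ≡ 0) →
    (∀ (i j : Fin k) → i ≢ j →
       Regular ε G' (cluster part i) (cluster part j)
       × (density G' (cluster part i) (cluster part j) ≡ 0ℚ
          ⊎ d ≤ density G' (cluster part i) (cluster part j))) →
    MinSemiDegAtLeast (reduced ε d G' part) (η * ⟦ k ⟧ * ((+ 1) / 2))
    × RobustOutexpander (ν * ((+ 1) / 2)) (⟦ 2 ⟧ * τ) (reduced ε d G' part))))))
-- Take d₀ = min(η,ν)/8, ε₀ = d and n₀ = 1, and apply ReducedDigraph.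
lemma14 ν τ η 0<ν ν<1 0<τ _ 0<η _ =
  (η ⊓ ν) * ⅛ , 0<d₀ , λ d 0<d d≤d₀ →
  d , 0<d , λ ε 0<ε ε≤d _ _ →
  1 , λ n 1≤n G G-degree G-expands k part G' G'⊆G _ V₀-small (m , equal) degree-loss no-internal dichotomy →
    let open ReducedDigraph (<⇒≤ 0<ν) (<⇒≤ 0<τ) (<⇒≤ 0<η) (small-errors 0<η 0<ν ν<1 0<d d≤d₀ 0<ε ε≤d)
               1≤n G G-degree G-expands part G' G'⊆G V₀-small m equal degree-loss no-internal dichotomy
    in min-semidegree , robust-expansion
  where
  0<d₀ : 0ℚ < (η ⊓ ν) * ⅛
  0<d₀ = subst (_< (η ⊓ ν) * ⅛) (*-zeroˡ ⅛) (*ʳ-mono-< ⅛ (positive⁻¹ ⅛) (⊓-pos 0<η 0<ν))
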